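{- Let $P$ be an $n$-element poset and $1\le i\le n-1$. The relation $t_i=1$ holds in $\mathcal{BK}_P$ if and only if $P$ can be written as an ordinal sum $P=P_1\oplus P_2$ with $|P_1|=i$.
   Context: A linear extension of $P$ is a list $(p_1,\dots,p_n)$ of all elements of $P$ with $p_a<_P p_b$ implying $a<b$; ${\mathcal{L}}(P)$ is the set of these. The Bender--Knuth move $t_i$ acts on ${\mathcal{L}}(P)$ by swapping $p_i,p_{i+1}$ if they are incomparable and fixing the list otherwise. $\mathcal{BK}_P$ is the permutation group on ${\mathcal{L}}(P)$ generated by $t_1,\dots,t_{n-1}$; $t_i=1$ holds means $t_i$ fixes every linear extension. The ordinal sum $P_1\oplus P_2$ is the disjoint union of $P_1,P_2$ with every element of $P_1$ below every element of $P_2$. -}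

module Defs where

open import Level using (0ℓ)
open import Data.Nat using (ℕ; suc; _≤_; _<_)
open import Data.Fin using (Fin; fromℕ<) renaming (_<_ to _<ᶠ_)
open import Data.Fin.Subset using (Subset; _∈_; _∉_; ∣_∣)
open import Data.Fin.Permutation.Components using (transpose)
open import Data.Product using (Σ; _×_; _,_)
open import Data.Sum using (_⊎_)
open import Relation.Nullary using (Dec; yes; no; ¬_)
open import Relation.Binary using (Rel; Decidable; IsStrictPartialOrder)
open import Relation.Binary.PropositionalEquality using (_≡_)
open import Function.Definitions using (Injective)
import Data.Nat.Properties

record FinPoset (n : ℕ) : Set₁ where
  field
    _<P_   : Rel (Fin n) 0ℓ
    isSPO  : IsStrictPartialOrder _≡_ _<P_
    _<P?_  : Decidable _<P_

module _ {n : ℕ} (P : FinPoset n) where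
  open FinPoset P

  -- A list (p_0,...,p_{n-1}) (0-indexed) of all elements of P, as a function
  -- from positions to elements; it lists all elements exactly once (injective
  -- on Fin n, hence bijective), and p_a <P p_b implies a < b.
  IsLinExt : (Fin n → Fin n) → Set
  IsLinExt p = Injective _≡_ _≡_ p × (∀ a b → p a <P p b → a <ᶠ b)

  Comparable : Fin n → Fin n → Set
  Comparable x y = x <P y ⊎ y <P x

  comparable? : ∀ x y → Dec (Comparable x y)
  comparable? x y with x <P? y | y <P? x
  ... | yes p | _ = yes (_⊎_.inj₁ p)
  ... | no _ | yes q = yes (_⊎_.inj₂ q)
  ... | no ¬p | no ¬q = no λ { (_⊎_.inj₁ p) → ¬p p ; (_⊎_.inj₂ q) → ¬q q }

  -- Bender–Knuth move t_i (1 ≤ i ≤ n-1): swaps p_i and p_{i+1} (1-indexed),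
  -- i.e. 0-indexed positions i-1 and i, if incomparable; else fixes the list.
  BK : (i : ℕ) → suc i ≤ n → (Fin n → Fin n) → (Fin n → Fin n)
  BK ℕ.zero    i<n p = p
  BK (ℕ.suc j) i<n p with comparable? (p a) (p b)
    where a = fromℕ< {j} (Data.Nat.Properties.<-trans (Data.Nat.Properties.n<1+n j) i<n)
          b = fromℕ< i<n
  ... | yes _ = p
  ... | no  _ = λ k → p (transpose (fromℕ< {j} (Data.Nat.Properties.<-trans (Data.Nat.Properties.n<1+n j) i<n)) (fromℕ< i<n) k)

  BKTrivial : (i : ℕ) → suc i ≤ n → Set
  BKTrivial i i<n = ∀ p → IsLinExt p → ∀ k → BK i i<n p k ≡ p k

  OrdinalSumSplit : ℕ → Set
  OrdinalSumSplit i = Σ (Subset n) λ S → (∣ S ∣ ≡ i) × (∀ x y → x ∈ S → y ∉ S → x <P y)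

{-# OPTIONS --safe #-}
-- If P = P₁ ⊕ P₂ with |P₁| = i, every linear extension lists P₁ in its first i positions, so
-- p_i ∈ P₁ and p_{i+1} ∈ P₂ are comparable and t_i fixes it. Conversely, take a down-set S of
-- size i. If some element of S is not below some element outside S, there is such a pair
-- (x, y) with x maximal in S and y minimal outside S; sorting P by the layers
-- S ∖ {x} < x < y < ∁S ∖ {y}, each layer by number of predecessors, gives a linear extension
-- with p_i = x and p_{i+1} = y incomparable, which t_i moves.
module Submission where

open import Level using (Level; 0ℓ)
open import Data.Bool.Base using (true; false; if_then_else_)
open import Data.Nat.Base using (ℕ; zero; suc; _+_; _*_; _≤_; _<_; z≤n; s≤s)
open import Data.Nat.Properties
  using (≤-refl; ≤-trans; ≤-antisym; ≤-reflexive; <⇒≤; <⇒≱; ≤⇒≯; <-irrefl; <-trans; <⇒≢; <-cmp; _<?_;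
         module ≤-Reasoning;
         +-comm; +-cancelˡ-≡; +-monoʳ-<; +-mono-≤-<; *-monoˡ-≤; m≤m+n; n<1+n)
open import Data.Fin.Base using (Fin; zero; suc; toℕ; fromℕ<; punchOut)
open import Data.Fin.Properties
  using (any?; _≟_; 0≢1+n; toℕ-fromℕ<; toℕ-injective; toℕ<n; punchOut-injective; injective⇒≤)
  renaming (suc-injective to Fin-suc-injective)
open import Data.Fin.Induction using (spo-wellFounded; spo-noetherian)
open import Data.Fin.Permutation.Components using (transpose)
open import Data.Fin.Permutation
  using (Permutation′; permutation; _⟨$⟩ʳ_; _⟨$⟩ˡ_; inverseˡ; inverseʳ) renaming (flip to flipₚ)
open import Data.Fin.Subset using (Subset; _∈_; _∉_; _⊆_; _-_; ∣_∣; ⊥; inside; outside)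
open import Data.Fin.Subset.Properties
  using (_∈?_; ∉⊥; ∈⊤; ∣⊥∣≡0; ∣⊤∣≡n; p⊆q⇒∣p∣≤∣q∣; p⊂q⇒∣p∣<∣q∣; x∈p∧x≢y⇒x∈p-y; x∈p⇒∣p-x∣<∣p∣)
open import Data.Vec.Base using ([]; _∷_; tabulate; here; there)
open import Data.Vec.Properties using (lookup∘tabulate; []=⇒lookup; lookup⇒[]=)
open import Data.Product using (∃; _×_; _,_; proj₁; proj₂)
open import Data.Sum using (inj₁; inj₂)
open import Function using (_∘_; flip)
open import Function.Bundles using (_⇔_; mk⇔; Injection; Equivalence)
open import Function.Properties.Inverse using (↔⇒↣)
open import Function.Definitions using (Injective)
open import Induction.WellFounded using (WellFounded; Acc; acc)
open import Relation.Binary using (Rel; Decidable; Transitive; IsStrictPartialOrder; tri<; tri≈; tri>)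
open import Relation.Binary.PropositionalEquality using (_≡_; _≢_; refl; sym; trans; cong; subst; subst₂)
open import Relation.Nullary using (¬_; ¬?; Dec; yes; no; does; contradiction)
open import Relation.Nullary.Decidable using (dec-true; dec-false; _×-dec_)
open import Relation.Unary using (Pred) renaming (Decidable to Decidable₁)

open import Defs

private
  variable
    ℓ ℓ′ : Level
    m n : ℕ

injective⇒surjective : {f : Fin n → Fin n} → Injective _≡_ _≡_ f → ∀ y → ∃ λ x → f x ≡ y
injective⇒surjective {suc n} {f} f-inj y with any? (λ x → f x ≟ y)
... | yes hit = hit
... | no miss = contradiction (injective⇒≤ {f = punched} punched-injective) (<-irrefl refl)
  where
  punched : Fin (suc n) → Fin n
  punched x = punchOut {i = y} (λ y≡fx → miss (x , sym y≡fx))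
  punched-injective : Injective _≡_ _≡_ punched
  punched-injective {x} {x′} eq = f-inj (punchOut-injective {i = y} {f x} {f x′} _ _ eq)

injective⇒permutation : {f : Fin n → Fin n} → Injective _≡_ _≡_ f → Permutation′ n
injective⇒permutation {f = f} f-inj =
  permutation f (proj₁ ∘ surjective) (proj₂ ∘ surjective) (λ x → f-inj (proj₂ (surjective (f x))))
  where
  surjective : ∀ y → ∃ λ x → f x ≡ y
  surjective = injective⇒surjective f-inj

satisfying : {Q : Pred (Fin n) ℓ} → Decidable₁ Q → Subset n
satisfying Q? = tabulate (does ∘ Q?)

module _ {Q : Pred (Fin n) ℓ} (Q? : Decidable₁ Q) {x : Fin n} where

  ∈-satisfying⁺ : Q x → x ∈ satisfying Q?
  ∈-satisfying⁺ q = lookup⇒[]= x _ (trans (lookup∘tabulate (does ∘ Q?) x) (dec-true (Q? x) q))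

  ∈-satisfying⁻ : x ∈ satisfying Q? → Q x
  ∈-satisfying⁻ x∈ with Q? x | trans (sym (lookup∘tabulate (does ∘ Q?) x)) ([]=⇒lookup x∈)
  ... | yes q | _ = q
  ... | no _  | ()

preimage : (Fin m → Fin n) → Subset n → Subset m
preimage f S = satisfying (λ x → f x ∈? S)

module _ (f : Fin m → Fin n) (S : Subset n) {x : Fin m} where

  ∈-preimage⁺ : f x ∈ S → x ∈ preimage f S
  ∈-preimage⁺ = ∈-satisfying⁺ (λ x → f x ∈? S)

  ∈-preimage⁻ : x ∈ preimage f S → f x ∈ S
  ∈-preimage⁻ = ∈-satisfying⁻ (λ x → f x ∈? S)

∣p∣≤∣q∣-by-injection : {f : Fin m → Fin n} → Injective _≡_ _≡_ f →
                       {p : Subset m} {q : Subset n} → (∀ {x} → x ∈ p → f x ∈ q) → ∣ p ∣ ≤ ∣ q ∣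
∣p∣≤∣q∣-by-injection _ {[]} _ = z≤n
∣p∣≤∣q∣-by-injection f-inj {outside ∷ p} p↦q =
  ∣p∣≤∣q∣-by-injection (Fin-suc-injective ∘ f-inj) (p↦q ∘ there)
∣p∣≤∣q∣-by-injection {f = f} f-inj {inside ∷ p} {q} p↦q =
  ≤-trans (s≤s (∣p∣≤∣q∣-by-injection (Fin-suc-injective ∘ f-inj) p↦q-f0)) (x∈p⇒∣p-x∣<∣p∣ (p↦q here))
  where
  p↦q-f0 : ∀ {x} → x ∈ p → f (suc x) ∈ q - f zero
  p↦q-f0 x∈p = x∈p∧x≢y⇒x∈p-y (p↦q (there x∈p)) (0≢1+n ∘ sym ∘ f-inj)

∣preimage∣≡∣∣ : {f : Fin n → Fin n} → Injective _≡_ _≡_ f → (S : Subset n) → ∣ preimage f S ∣ ≡ ∣ S ∣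
∣preimage∣≡∣∣ {n} {f} f-inj S = ≤-antisym
  (∣p∣≤∣q∣-by-injection f-inj (∈-preimage⁻ f S))
  (∣p∣≤∣q∣-by-injection {f = π ⟨$⟩ˡ_} (Injection.injective (↔⇒↣ (flipₚ π)))
    (∈-preimage⁺ f S ∘ subst (_∈ S) (sym (inverseʳ π))))
  where
  π : Permutation′ n
  π = injective⇒permutation f-inj

initial : ℕ → Subset n
initial {zero}  _       = []
initial {suc n} zero    = ⊥
initial {suc n} (suc k) = inside ∷ initial k

∣initial∣ : ∀ {k} → k ≤ n → ∣ initial {n} k ∣ ≡ k
∣initial∣ {zero}  z≤n       = refl
∣initial∣ {suc n} {zero} _  = ∣⊥∣≡0 n
∣initial∣ {suc n} (s≤s k≤n) = cong suc (∣initial∣ k≤n)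

∈-initial⁺ : ∀ {k} {x : Fin n} → toℕ x < k → x ∈ initial k
∈-initial⁺ {suc n} {suc k} {zero}  _         = here
∈-initial⁺ {suc n} {suc k} {suc x} (s≤s x<k) = there (∈-initial⁺ x<k)

∈-initial⁻ : ∀ {k} {x : Fin n} → x ∈ initial k → toℕ x < k
∈-initial⁻ {suc n} {zero}          x∈        = contradiction x∈ ∉⊥
∈-initial⁻ {suc n} {suc k} {zero}  _         = s≤s z≤n
∈-initial⁻ {suc n} {suc k} {suc x} (there x∈) = s≤s (∈-initial⁻ x∈)

module _ {A : Subset n} (A-before-∁A : ∀ {k l} → k ∈ A → l ∉ A → toℕ k < toℕ l) where

  cut-is-initial : ∀ x → x ∈ A ⇔ toℕ x < ∣ A ∣
  cut-is-initial x = mk⇔ to from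
    where
    to : x ∈ A → toℕ x < ∣ A ∣
    to x∈A = subst (_≤ ∣ A ∣) (∣initial∣ (toℕ<n x)) (p⊆q⇒∣p∣≤∣q∣ upTo-x⊆A)
      where
      upTo-x⊆A : initial (suc (toℕ x)) ⊆ A
      upTo-x⊆A {k} k∈ with k ∈? A
      ... | yes k∈A = k∈A
      ... | no  k∉A = contradiction (∈-initial⁻ k∈) (<⇒≱ (s≤s (A-before-∁A x∈A k∉A)))

    from : toℕ x < ∣ A ∣ → x ∈ A
    from x<∣A∣ with x ∈? A
    ... | yes x∈A = x∈A
    ... | no  x∉A = contradiction ∣A∣≤x (<⇒≱ x<∣A∣)
      where
      A⊆below-x : A ⊆ initial (toℕ x)
      A⊆below-x k∈A = ∈-initial⁺ (A-before-∁A k∈A x∉A)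
      ∣A∣≤x : ∣ A ∣ ≤ toℕ x
      ∣A∣≤x = subst (∣ A ∣ ≤_) (∣initial∣ (<⇒≤ (toℕ<n x))) (p⊆q⇒∣p∣≤∣q∣ A⊆below-x)

module Downsets {_≺_ : Rel (Fin n) ℓ} (≺-irrefl : ∀ {x} → ¬ x ≺ x) (≺-trans : Transitive _≺_)
                (_≺?_ : Decidable _≺_) where

  ↓ : Fin n → Subset n
  ↓ x = satisfying (_≺? x)

  ∣↓∣<n : ∀ x → ∣ ↓ x ∣ < n
  ∣↓∣<n x = subst (∣ ↓ x ∣ <_) (∣⊤∣≡n n)
    (p⊂q⇒∣p∣<∣q∣ ((λ _ → ∈⊤) , x , ∈⊤ , ≺-irrefl ∘ ∈-satisfying⁻ (_≺? x)))

  ∣↓∣-monotone : ∀ {x y} → x ≺ y → ∣ ↓ x ∣ < ∣ ↓ y ∣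
  ∣↓∣-monotone {x} {y} x≺y =
    p⊂q⇒∣p∣<∣q∣ (↓x⊆↓y , x , ∈-satisfying⁺ (_≺? y) x≺y , ≺-irrefl ∘ ∈-satisfying⁻ (_≺? x))
    where
    ↓x⊆↓y : ↓ x ⊆ ↓ y
    ↓x⊆↓y z∈ = ∈-satisfying⁺ (_≺? y) (≺-trans (∈-satisfying⁻ (_≺? x) z∈) x≺y)

lexicographic-< : ∀ {a b c d} → a < b → c < n → a * n + c < b * n + d
lexicographic-< {n} {a} {b} {c} {d} a<b c<n = begin-strict
  a * n + c  <⟨ +-monoʳ-< (a * n) c<n ⟩
  a * n + n  ≡⟨ +-comm (a * n) n ⟩
  suc a * n  ≤⟨ *-monoˡ-≤ n a<b ⟩
  b * n      ≤⟨ m≤m+n (b * n) d ⟩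
  b * n + d  ∎
  where open ≤-Reasoning

module SortBy (weight : Fin n → ℕ) where

  private
    key : Fin n → ℕ
    key x = weight x * n + toℕ x

    key-monotone : ∀ {x y} → weight x < weight y → key x < key y
    key-monotone {x} w<w = lexicographic-< w<w (toℕ<n x)

    key-injective : Injective _≡_ _≡_ key
    key-injective {x} {y} eq with <-cmp (weight x) (weight y)
    ... | tri< w<w _ _ = contradiction eq (<⇒≢ (key-monotone w<w))
    ... | tri> _ _ w>w = contradiction (sym eq) (<⇒≢ (key-monotone w>w))
    ... | tri≈ _ w≡w _ = toℕ-injective
      (+-cancelˡ-≡ (weight x * n) _ _ (trans eq (cong (λ w → w * n + toℕ y) (sym w≡w))))

    _≺_ : Rel (Fin n) 0ℓ
    x ≺ y = key x < key y

    open Downsets {_≺_ = _≺_} (<-irrefl refl) <-trans (λ x y → key x <? key y)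

  rank : Fin n → Fin n
  rank x = fromℕ< (∣↓∣<n x)

  private
    rank-≺ : ∀ {x y} → key x < key y → toℕ (rank x) < toℕ (rank y)
    rank-≺ = subst₂ _<_ (sym (toℕ-fromℕ< _)) (sym (toℕ-fromℕ< _)) ∘ ∣↓∣-monotone

  rank-monotone : ∀ {x y} → weight x < weight y → toℕ (rank x) < toℕ (rank y)
  rank-monotone = rank-≺ ∘ key-monotone

  rank-injective : Injective _≡_ _≡_ rank
  rank-injective {x} {y} eq with <-cmp (key x) (key y)
  ... | tri< k<k _ _ = contradiction (cong toℕ eq) (<⇒≢ (rank-≺ k<k))
  ... | tri> _ _ k>k = contradiction (cong toℕ (sym eq)) (<⇒≢ (rank-≺ k>k))
  ... | tri≈ _ k≡k _ = key-injective k≡k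

  private
    ranking : Permutation′ n
    ranking = injective⇒permutation rank-injective

  sorted : Fin n → Fin n
  sorted = ranking ⟨$⟩ˡ_

  sorted-injective : Injective _≡_ _≡_ sorted
  sorted-injective = Injection.injective (↔⇒↣ (flipₚ ranking))

  sorted-rank : ∀ x → sorted (rank x) ≡ x
  sorted-rank x = inverseˡ ranking

  sorted-reflects : ∀ {k l} → weight (sorted k) < weight (sorted l) → toℕ k < toℕ l
  sorted-reflects = subst₂ _<_ (cong toℕ (inverseʳ ranking)) (cong toℕ (inverseʳ ranking)) ∘ rank-monotone

module _ {_≺_ : Rel (Fin n) ℓ} (≺-wellFounded : WellFounded _≺_) (_≺?_ : Decidable _≺_)
         {Q : Pred (Fin n) ℓ′} (Q? : Decidable₁ Q) where

  minimal : ∀ {x} → Q x → ∃ λ m → Q m × (∀ {z} → Q z → ¬ z ≺ m)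
  minimal {x} = go (≺-wellFounded x)
    where
    go : ∀ {x} → Acc _≺_ x → Q x → ∃ λ m → Q m × (∀ {z} → Q z → ¬ z ≺ m)
    go {x} (acc below) qx with any? (λ z → Q? z ×-dec z ≺? x)
    ... | yes (z , qz , z≺x) = go (below z≺x) qz
    ... | no none = x , qx , λ qz z≺x → none (_ , qz , z≺x)

listed-first : {p : Fin n → Fin n} → Injective _≡_ _≡_ p → {S : Subset n} →
               (∀ {k l} → p k ∈ S → p l ∉ S → toℕ k < toℕ l) → ∀ k → p k ∈ S ⇔ toℕ k < ∣ S ∣
listed-first {p = p} p-inj {S} S-first k = mk⇔
  (subst (toℕ k <_) ∣A∣≡∣S∣ ∘ to ∘ ∈-preimage⁺ p S)
  (∈-preimage⁻ p S ∘ from ∘ subst (toℕ k <_) (sym ∣A∣≡∣S∣))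
  where
  A : Subset _
  A = preimage p S
  ∣A∣≡∣S∣ : ∣ A ∣ ≡ ∣ S ∣
  ∣A∣≡∣S∣ = ∣preimage∣≡∣∣ p-inj S
  open Equivalence
    (cut-is-initial {A = A} (λ k∈A l∉A → S-first (∈-preimage⁻ p S k∈A) (l∉A ∘ ∈-preimage⁺ p S)) k)

module _ (P : FinPoset n) where
  open FinPoset P
  open IsStrictPartialOrder isSPO using (irrefl) renaming (trans to <P-trans)

  open Downsets {_≺_ = _<P_} (irrefl refl) <P-trans _<P?_
    renaming (∣↓∣<n to height<n; ∣↓∣-monotone to height-monotone)

  height : Fin n → ℕ
  height x = ∣ ↓ x ∣

  IsDownSet : Subset n → Set
  IsDownSet S = ∀ {u v} → u <P v → v ∈ S → u ∈ S

  downset-of-size : ∀ {i} → i ≤ n → ∃ λ S → ∣ S ∣ ≡ i × IsDownSet S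
  downset-of-size {i} i≤n =
    preimage rank (initial i) ,
    trans (∣preimage∣≡∣∣ rank-injective _) (∣initial∣ i≤n) ,
    λ u<v v∈S → ∈-preimage⁺ rank (initial i) (∈-initial⁺
      (<-trans (rank-monotone (height-monotone u<v)) (∈-initial⁻ (∈-preimage⁻ rank (initial i) v∈S))))
    where open SortBy height using (rank; rank-injective; rank-monotone)

  sorted-isLinExt : (weight : Fin n → ℕ) → (∀ {x y} → x <P y → weight x < weight y) →
                    IsLinExt P (SortBy.sorted weight)
  sorted-isLinExt weight weight-monotone =
    sorted-injective , λ _ _ → sorted-reflects ∘ weight-monotone
    where open SortBy weight

  record BoundaryPair (S : Subset n) : Set where
    field
      x y       : Fin n
      x∈S       : x ∈ S
      y∉S       : y ∉ S
      x≮y       : ¬ x <P y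
      x-maximal : ∀ {z} → z ∈ S → ¬ x <P z
      y-minimal : ∀ {z} → z ∉ S → ¬ z <P y

  -- Push x up inside S while staying ≮ y, then push y down outside S while staying ≯ x.
  boundary-pair : ∀ {S x y} → x ∈ S → y ∉ S → ¬ x <P y → BoundaryPair S
  boundary-pair {S} {x} {y} x∈S y∉S x≮y
    with x′ , (x′∈S , x′≮y) , x′-maximal
           ← minimal (spo-noetherian isSPO) (flip _<P?_) (λ u → u ∈? S ×-dec ¬? (u <P? y)) (x∈S , x≮y)
    with y′ , (y′∉S , x′≮y′) , y′-minimal
           ← minimal (spo-wellFounded isSPO) _<P?_ (λ v → ¬? (v ∈? S) ×-dec ¬? (x′ <P? v)) (y∉S , x′≮y)
    = record
    { x∈S = x′∈S ; y∉S = y′∉S ; x≮y = x′≮y′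
    ; x-maximal = λ z∈S x′<z → x′-maximal (z∈S , x′≮y ∘ <P-trans x′<z) x′<z
    ; y-minimal = λ z∉S z<y′ → y′-minimal (z∉S , λ x′<z → x′≮y′ (<P-trans x′<z z<y′)) z<y′
    }

  module AdjacentBoundary {S : Subset n} (S-downward : IsDownSet S) (pair : BoundaryPair S) where
    open BoundaryPair pair

    band : Fin n → ℕ
    band u with u ∈? S
    ... | yes _ = if does (u ≟ x) then 1 else 0
    ... | no  _ = if does (u ≟ y) then 2 else 3

    band-∈ : ∀ {u} → u ∈ S → band u ≤ 1
    band-∈ {u} u∈S with u ∈? S
    ... | no u∉S = contradiction u∈S u∉S
    ... | yes _ with does (u ≟ x)
    ...   | true  = ≤-refl
    ...   | false = z≤n

    band-∉ : ∀ {u} → u ∉ S → 2 ≤ band u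
    band-∉ {u} u∉S with u ∈? S
    ... | yes u∈S = contradiction u∈S u∉S
    ... | no _ with does (u ≟ y)
    ...   | true  = ≤-refl
    ...   | false = s≤s (s≤s z≤n)

    band-∈∖x : ∀ {u} → u ∈ S → u ≢ x → band u ≡ 0
    band-∈∖x {u} u∈S u≢x with u ∈? S
    ... | yes _ rewrite dec-false (u ≟ x) u≢x = refl
    ... | no u∉S = contradiction u∈S u∉S

    band-∉∖y : ∀ {u} → u ∉ S → u ≢ y → band u ≡ 3
    band-∉∖y {u} u∉S u≢y with u ∈? S
    ... | no _ rewrite dec-false (u ≟ y) u≢y = refl
    ... | yes u∈S = contradiction u∈S u∉S

    band-x : band x ≡ 1
    band-x with x ∈? S
    ... | yes _ rewrite dec-true (x ≟ x) refl = refl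
    ... | no x∉S = contradiction x∈S x∉S

    band-y : band y ≡ 2
    band-y with y ∈? S
    ... | no _ rewrite dec-true (y ≟ y) refl = refl
    ... | yes y∈S = contradiction y∈S y∉S

    band≤3 : ∀ u → band u ≤ 3
    band≤3 u = by-cases (u ∈? S) (u ≟ y)
      where
      by-cases : Dec (u ∈ S) → Dec (u ≡ y) → band u ≤ 3
      by-cases (yes u∈S) _        = ≤-trans (band-∈ u∈S) (s≤s z≤n)
      by-cases (no _)    (yes refl) = ≤-trans (≤-reflexive band-y) (s≤s (s≤s z≤n))
      by-cases (no u∉S)  (no u≢y)   = ≤-reflexive (band-∉∖y u∉S u≢y)

    band-monotone : ∀ {u v} → u <P v → band u ≤ band v
    band-monotone {u} {v} u<v = by-cases (v ∈? S) (v ≟ y)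
      where
      by-cases : Dec (v ∈ S) → Dec (v ≡ y) → band u ≤ band v
      by-cases (yes v∈S) _ = ≤-trans (≤-reflexive (band-∈∖x (S-downward u<v v∈S) u≢x)) z≤n
        where
        u≢x : u ≢ x
        u≢x refl = x-maximal v∈S u<v
      by-cases (no _) (yes refl) = ≤-trans (band-∈ u∈S) (≤-trans (s≤s z≤n) (band-∉ y∉S))
        where
        u∈S : u ∈ S
        u∈S with u ∈? S
        ... | yes u∈S = u∈S
        ... | no  u∉S = contradiction u<v (y-minimal u∉S)
      by-cases (no v∉S) (no v≢y) = subst (band u ≤_) (sym (band-∉∖y v∉S v≢y)) (band≤3 u)

    weight : Fin n → ℕ
    weight u = band u * n + height u

    weight-monotone : ∀ {u v} → u <P v → weight u < weight v
    weight-monotone u<v = +-mono-≤-< (*-monoˡ-≤ n (band-monotone u<v)) (height-monotone u<v)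

    weight-band : ∀ {u v} → band u < band v → weight u < weight v
    weight-band {u} = flip lexicographic-< (height<n u)

    open SortBy weight public using (sorted)
    open SortBy weight using (rank; sorted-rank; sorted-injective; sorted-reflects)

    sorted-position : ∀ k → sorted k ∈ S ⇔ toℕ k < ∣ S ∣
    sorted-position = listed-first sorted-injective λ k∈S l∉S →
      sorted-reflects (weight-band (≤-trans (s≤s (band-∈ k∈S)) (band-∉ l∉S)))

    sorted-x : ∀ {k} → suc (toℕ k) ≡ ∣ S ∣ → sorted k ≡ x
    sorted-x {k} k+1≡∣S∣ with sorted k ≟ x
    ... | yes kx = kx
    ... | no k≢x = contradiction rank-x<k+1 (≤⇒≯ k<rank-x)
      where
      k∈S : sorted k ∈ S
      k∈S = Equivalence.from (sorted-position k) (≤-reflexive k+1≡∣S∣)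
      k<rank-x : toℕ k < toℕ (rank x)
      k<rank-x = sorted-reflects (subst (λ z → weight (sorted k) < weight z) (sym (sorted-rank x))
        (weight-band (subst₂ _<_ (sym (band-∈∖x k∈S k≢x)) (sym band-x) ≤-refl)))
      rank-x<k+1 : toℕ (rank x) < suc (toℕ k)
      rank-x<k+1 = subst (toℕ (rank x) <_) (sym k+1≡∣S∣)
        (Equivalence.to (sorted-position (rank x)) (subst (_∈ S) (sym (sorted-rank x)) x∈S))

    sorted-y : ∀ {k} → toℕ k ≡ ∣ S ∣ → sorted k ≡ y
    sorted-y {k} k≡∣S∣ with sorted k ≟ y
    ... | yes ky = ky
    ... | no k≢y = contradiction
      (subst (_∈ S) (sorted-rank y) (Equivalence.from (sorted-position (rank y)) rank-y<∣S∣)) y∉S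
      where
      k∉S : sorted k ∉ S
      k∉S k∈S = <-irrefl k≡∣S∣ (Equivalence.to (sorted-position k) k∈S)
      rank-y<∣S∣ : toℕ (rank y) < ∣ S ∣
      rank-y<∣S∣ = subst (toℕ (rank y) <_) k≡∣S∣ (sorted-reflects
        (subst (λ z → weight z < weight (sorted k)) (sym (sorted-rank y))
          (weight-band (subst₂ _<_ (sym band-y) (sym (band-∉∖y k∉S k≢y)) ≤-refl))))

  module _ {j : ℕ} (i<n : suc (suc j) ≤ n) where

    private
      a b : Fin n
      a = fromℕ< {j} (<-trans (n<1+n j) i<n)
      b = fromℕ< i<n

      toℕ-a : toℕ a ≡ j
      toℕ-a = toℕ-fromℕ< _

      toℕ-b : toℕ b ≡ suc j
      toℕ-b = toℕ-fromℕ< i<n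

      a≢b : a ≢ b
      a≢b a≡b = <-irrefl (trans (sym toℕ-a) (trans (cong toℕ a≡b) toℕ-b)) (n<1+n j)

      transpose-source : ∀ (k l : Fin n) → transpose k l k ≡ l
      transpose-source k l rewrite dec-true (k ≟ k) refl = refl

    BK-fixes⇒comparable : ∀ {p} → IsLinExt P p → (∀ k → BK P (suc j) i<n p k ≡ p k) →
                          Comparable P (p a) (p b)
    BK-fixes⇒comparable {p} (p-injective , _) fixes with comparable? P (p a) (p b) | fixes a
    ... | yes comparable | _ = comparable
    ... | no _ | pb≡pa =
      contradiction (p-injective (trans (cong p (sym (transpose-source a b))) pb≡pa)) (a≢b ∘ sym)

    comparable⇒BK-fixes : ∀ {p} → Comparable P (p a) (p b) → ∀ k → BK P (suc j) i<n p k ≡ p k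
    comparable⇒BK-fixes {p} comparable _ with comparable? P (p a) (p b)
    ... | yes _ = refl
    ... | no incomparable = contradiction comparable incomparable

    ordinal-sum⇒BK-trivial : OrdinalSumSplit P (suc j) → BKTrivial P (suc j) i<n
    ordinal-sum⇒BK-trivial (S , ∣S∣≡i , S-below-∁S) p (p-injective , p-monotone) =
      comparable⇒BK-fixes (inj₁ (S-below-∁S _ _ pa∈S pb∉S))
      where
      position : ∀ k → p k ∈ S ⇔ toℕ k < suc j
      position k = subst (λ s → p k ∈ S ⇔ toℕ k < s) ∣S∣≡i
        (listed-first p-injective (λ k∈S l∉S → p-monotone _ _ (S-below-∁S _ _ k∈S l∉S)) k)
      pa∈S : p a ∈ S
      pa∈S = Equivalence.from (position a) (≤-reflexive (cong suc toℕ-a))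
      pb∉S : p b ∉ S
      pb∉S pb∈S = <-irrefl toℕ-b (Equivalence.to (position b) pb∈S)

    -- Otherwise a boundary pair of S sits incomparable at positions i, i + 1 of some linear extension.
    BK-trivial⇒downset-below-complement : BKTrivial P (suc j) i<n → ∀ {S} → ∣ S ∣ ≡ suc j → IsDownSet S →
                                          ∀ x y → x ∈ S → y ∉ S → x <P y
    BK-trivial⇒downset-below-complement trivial {S} ∣S∣≡i S-downward u v u∈S v∉S with u <P? v
    ... | yes u<v = u<v
    ... | no  u≮v = contradiction (BK-fixes⇒comparable linear (trivial sorted linear)) incomparable
      where
      pair : BoundaryPair S
      pair = boundary-pair u∈S v∉S u≮v
      open BoundaryPair pair using (x; y; x∈S; y∉S; x≮y)
      open AdjacentBoundary S-downward pair using (weight; weight-monotone; sorted; sorted-x; sorted-y)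

      linear : IsLinExt P sorted
      linear = sorted-isLinExt weight weight-monotone

      a-holds-x : sorted a ≡ x
      a-holds-x = sorted-x (trans (cong suc toℕ-a) (sym ∣S∣≡i))
      b-holds-y : sorted b ≡ y
      b-holds-y = sorted-y (trans toℕ-b (sym ∣S∣≡i))

      incomparable : ¬ Comparable P (sorted a) (sorted b)
      incomparable (inj₁ a<b) = x≮y (subst₂ _<P_ a-holds-x b-holds-y a<b)
      incomparable (inj₂ b<a) = y∉S (S-downward (subst₂ _<P_ b-holds-y a-holds-x b<a) x∈S)

    BK-trivial⇒ordinal-sum : BKTrivial P (suc j) i<n → OrdinalSumSplit P (suc j)
    BK-trivial⇒ordinal-sum trivial with S , ∣S∣≡i , S-downward ← downset-of-size (<⇒≤ i<n) =
      S , ∣S∣≡i , BK-trivial⇒downset-below-complement trivial ∣S∣≡i S-downward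

proposition3p1 : (n : ℕ) (P : FinPoset n) (i : ℕ) → 1 ≤ i → (i<n : suc i ≤ n) →
    BKTrivial P i i<n ⇔ OrdinalSumSplit P i
proposition3p1 n P (suc j) _ i<n = mk⇔ (BK-trivial⇒ordinal-sum P i<n) (ordinal-sum⇒BK-trivial P i<n)
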